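{- Let $\mathcal{C}$ be a small category which has no endomorphisms other than identities, let $I$ be a set, and let $\ell\colon \operatorname{Mor}(\mathcal{C})\to I$ be a map. Suppose that for all morphisms $f,g$ of $\mathcal{C}$ with $\ell(f)=\ell(g)$ there exists a functor $\varphi_{f,g}\colon \mathcal{C}_f\to\mathcal{C}_g$ such that (1) the map on morphisms $\varphi^{\mathrm{Mor}}_{f,g}\colon\operatorname{Mor}(\mathcal{C}_f)\to\operatorname{Mor}(\mathcal{C}_g)$ is a bijection; (2) $\ell(f')=\ell(\varphi^{\mathrm{Mor}}_{f,g}(f'))$ for every morphism $f'$ of $\mathcal{C}_f$; and (3) $\varphi^{\mathrm{Mor}}_{f,g}(f)=g$. Then $(\mathcal{C},I,\ell)$ is a schemoid.
   Context: For a small category $\mathcal{C}$, a set $I$ and a map $\ell\colon\operatorname{Mor}(\mathcal{C})\to I$, and for $i,j\in I$ and $h\in\operatorname{Mor}(\mathcal{C})$, let $N^{i,j}_h=\{(f,g)\in\operatorname{Mor}(\mathcal{C})\times\operatorname{Mor}(\mathcal{C}) : \ell(f)=i,\ \ell(g)=j,\ f\circ g=h\}$. The triple $(\mathcal{C},I,\ell)$ is called a schemoid if for all $i,j\in I$ and all $h,k\in\operatorname{Mor}(\mathcal{C})$ with $\ell(h)=\ell(k)$, the sets $N^{i,j}_h$ and $N^{i,j}_k$ have the same cardinality. For a morphism $f$ of $\mathcal{C}$, $\mathcal{C}_f$ denotes the smallest subcategory of $\mathcal{C}$ whose set of morphisms contains $\{g\in\operatorname{Mor}(\mathcal{C}) :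 f_1\circ g\circ f_2=f \text{ for some } f_1,f_2\in\operatorname{Mor}(\mathcal{C})\}$. -}

module Defs where

open import Data.Product using (Σ; Σ-syntax; _×_; _,_)
open import Relation.Binary.PropositionalEquality using (_≡_)
open import Function.Bundles using (_↔_)

record Category : Set₁ where
  infixr 9 _∘_
  field
    Obj  : Set
    Hom  : Obj → Obj → Set
    id   : (a : Obj) → Hom a a
    _∘_  : ∀ {a b c} → Hom b c → Hom a b → Hom a c
    identityˡ : ∀ {a b} (f : Hom a b) → id b ∘ f ≡ f
    identityʳ : ∀ {a b} (f : Hom a b) → f ∘ id a ≡ f
    assoc : ∀ {a b c d} (f : Hom c d) (g : Hom b c) (h : Hom a b) →
            (f ∘ g) ∘ h ≡ f ∘ (g ∘ h)

module _ (C : Category) where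
  open Category C

  Mor : Set
  Mor = Σ[ a ∈ Obj ] Σ[ b ∈ Obj ] Hom a b

  NoNonIdentityEndos : Set
  NoNonIdentityEndos = ∀ a (e : Hom a a) → e ≡ id a

  Divides : ∀ {a b} → Hom a b → Mor → Set
  Divides {a} {b} h (x , y , f) = Σ[ f₁ ∈ Hom b y ] Σ[ f₂ ∈ Hom x a ] (f₁ ∘ h ∘ f₂ ≡ f)

  -- Membership in Mor(C_f): the smallest subcategory containing all divisors of f.
  -- (The divisors are closed under taking identities of their endpoints, so the
  --  closure under composition is already a subcategory, and it is the smallest.)
  data InSub (f : Mor) : Mor → Set where
    divisor : ∀ {a b} (h : Hom a b) → Divides h f → InSub f (a , b , h)
    comp    : ∀ {a b c} {h : Hom b c} {k : Hom a b} →
              InSub f (b , c , h) → InSub f (a , b , k) → InSub f (a , c , h ∘ k)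

  self∈Sub : (f : Mor) → InSub f f
  self∈Sub (x , y , f) =
    divisor f (id y , id x , Relation.Binary.PropositionalEquality.trans
                               (Relation.Binary.PropositionalEquality.cong (id y ∘_) (identityʳ f))
                               (identityˡ f))
    where import Relation.Binary.PropositionalEquality

  -- A functor C_f → C_g.  The morphism map is defined on members of Mor(C_f)
  -- and is required not to depend on the membership witness (Mor(C_f) is a subset).
  record SubFunctor (f g : Mor) : Set where
    field
      F₀    : Obj → Obj
      F₁    : ∀ {a b} (h : Hom a b) → InSub f (a , b , h) → Hom (F₀ a) (F₀ b)
      F₁-irr : ∀ {a b} (h : Hom a b) (p q : InSub f (a , b , h)) → F₁ h p ≡ F₁ h q
      F₁-in : ∀ {a b} (h : Hom a b) (p : InSub f (a , b , h)) →
              InSub g (F₀ a , F₀ b , F₁ h p)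
      F-id  : ∀ a (p : InSub f (a , a , id a)) → F₁ (id a) p ≡ id (F₀ a)
      F-∘   : ∀ {a b c} (h : Hom b c) (k : Hom a b)
              (p : InSub f (b , c , h)) (q : InSub f (a , b , k))
              (r : InSub f (a , c , h ∘ k)) →
              F₁ (h ∘ k) r ≡ F₁ h p ∘ F₁ k q

    FMor : (m : Mor) → InSub f m → Mor
    FMor (a , b , h) p = (F₀ a , F₀ b , F₁ h p)

  module _ {I : Set} (ℓ : Mor → I) where

    record GoodFunctor (f g : Mor) : Set where
      field
        φ : SubFunctor f g
      open SubFunctor φ public
      field
        injective  : ∀ m m' (p : InSub f m) (p' : InSub f m') → FMor m p ≡ FMor m' p' → m ≡ m'
        surjective : ∀ n → InSub g n → Σ[ m ∈ Mor ] Σ[ p ∈ InSub f m ] (FMor m p ≡ n)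
        label      : ∀ m (p : InSub f m) → ℓ m ≡ ℓ (FMor m p)
        sends      : FMor f (self∈Sub f) ≡ g

    N : I → I → Mor → Set
    N i j (x , z , h) =
      Σ[ y ∈ Obj ] Σ[ f ∈ Hom y z ] Σ[ g ∈ Hom x y ]
        (ℓ (y , z , f) ≡ i × ℓ (x , y , g) ≡ j × f ∘ g ≡ h)

    -- schemoid: equal cardinality = existence of a bijection
    IsSchemoid : Set
    IsSchemoid = ∀ i j h k → ℓ h ≡ ℓ k → N i j h ↔ N i j k

-- φ_{h,k} restricts to a bijection between the factorisations f ∘ g = h
-- and the factorisations f′ ∘ g′ = φ(h) = k, preserving the labels of the
-- factors.  Both factors of h are divisors of h, so φ applies to them; φ
-- preserves composition and labels, and it is injective on morphisms, which
-- gives injectivity of the restriction.  Conversely the two factors of k are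
-- divisors of k, hence lie in C_k and have preimages; injectivity of φ on the
-- identities of C_h makes these preimages composable, and faithfulness
-- turns the equation f′ ∘ g′ = φ(h) into an equation f ∘ g = h.
module Submission where

open import Defs
open import Relation.Binary.PropositionalEquality
  using (_≡_; refl; sym; trans; cong; subst; module ≡-Reasoning)
open import Data.Product using (Σ-syntax; _,_; proj₁; proj₂)
open import Function.Bundles using (_↔_; mk⤖)
open import Function.Properties.Bijection using (⤖⇒↔)
open import Function.Consequences.Propositional using (strictlySurjective⇒surjective)
open import Axiom.UniquenessOfIdentityProofs.WithK using (uip)

module _ (C : Category) where
  open Category C

  Hom-≡ : ∀ {a b} {u v : Hom a b} → _≡_ {A = Mor C} (a , b , u) (a , b , v) → u ≡ v
  Hom-≡ refl = refl

  left-factor∈Sub : ∀ {x y z} {f : Hom y z} {g : Hom x y} {h : Hom x z} →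
                    f ∘ g ≡ h → InSub C (x , z , h) (y , z , f)
  left-factor∈Sub {f = f} {g} e = divisor f (id _ , g , trans (identityˡ _) e)

  right-factor∈Sub : ∀ {x y z} {f : Hom y z} {g : Hom x y} {h : Hom x z} →
                     f ∘ g ≡ h → InSub C (x , z , h) (x , y , g)
  right-factor∈Sub {f = f} {g} e = divisor g (f , id _ , trans (cong (f ∘_) (identityʳ g)) e)

  id-cod∈Sub : ∀ {m a b} {u : Hom a b} → InSub C m (a , b , u) → InSub C m (b , b , id b)
  id-cod∈Sub {u = u} (divisor .u (f₁ , f₂ , e)) =
    divisor (id _) (f₁ , u ∘ f₂ , trans (cong (f₁ ∘_) (identityˡ _)) e)
  id-cod∈Sub (comp p q) = id-cod∈Sub p

  id-dom∈Sub : ∀ {m a b} {u : Hom a b} → InSub C m (a , b , u) → InSub C m (a , a , id a)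
  id-dom∈Sub {u = u} (divisor .u (f₁ , f₂ , e)) = divisor (id _) (f₁ ∘ u , f₂ , e′)
    where
    open ≡-Reasoning
    e′ : (f₁ ∘ u) ∘ id _ ∘ f₂ ≡ _
    e′ = begin
      (f₁ ∘ u) ∘ id _ ∘ f₂ ≡⟨ cong ((f₁ ∘ u) ∘_) (identityˡ f₂) ⟩
      (f₁ ∘ u) ∘ f₂        ≡⟨ assoc f₁ u f₂ ⟩
      f₁ ∘ u ∘ f₂          ≡⟨ e ⟩
      _                    ∎
  id-dom∈Sub (comp p q) = id-dom∈Sub q

  module _ {I : Set} {ℓ : Mor C → I} {i j : I} where

    N-≡ : ∀ {x z} {h : Hom x z} {y y′} {f : Hom y z} {f′ : Hom y′ z}
            {g : Hom x y} {g′ : Hom x y′} {li li′ lj lj′ e e′} →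
          _≡_ {A = Mor C} (y , z , f) (y′ , z , f′) →
          _≡_ {A = Mor C} (x , y , g) (x , y′ , g′) →
          _≡_ {A = N C ℓ i j (x , z , h)} (y , f , g , li , lj , e) (y′ , f′ , g′ , li′ , lj′ , e′)
    N-≡ {li = li} {li′} {lj} {lj′} {e} {e′} refl refl
      rewrite uip li li′ | uip lj lj′ | uip e e′ = refl

  module GoodFunctorProperties {I : Set} {ℓ : Mor C → I} {h k : Mor C}
                               (G : GoodFunctor C ℓ h k) where
    open GoodFunctor G

    F₁-cong : ∀ {a b} {u v : Hom a b} → u ≡ v →
              (p : InSub C h (a , b , u)) (q : InSub C h (a , b , v)) → F₁ u p ≡ F₁ v q
    F₁-cong refl = F₁-irr _

    F₁-faithful : ∀ {a b} {u v : Hom a b}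
                  (p : InSub C h (a , b , u)) (q : InSub C h (a , b , v)) → F₁ u p ≡ F₁ v q → u ≡ v
    F₁-faithful p q e = Hom-≡ (injective _ _ p q (cong (λ w → _ , _ , w) e))

    F₀-injective : ∀ {a b} → InSub C h (a , a , id a) → InSub C h (b , b , id b) →
                   F₀ a ≡ F₀ b → a ≡ b
    F₀-injective {a} {b} p q e = cong proj₁ (injective _ _ p q (begin
      F₀ a , F₀ a , F₁ (id a) p ≡⟨ cong (λ w → _ , _ , w) (F-id a p) ⟩
      F₀ a , F₀ a , id (F₀ a)   ≡⟨ cong (λ o → o , o , id o) e ⟩
      F₀ b , F₀ b , id (F₀ b)   ≡⟨ cong (λ w → _ , _ , w) (sym (F-id b q)) ⟩
      F₀ b , F₀ b , F₁ (id b) q ∎))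
      where open ≡-Reasoning

    F₁-surjective : ∀ {a b} → InSub C h (a , a , id a) → InSub C h (b , b , id b) →
                    (w : Hom (F₀ a) (F₀ b)) → InSub C k (F₀ a , F₀ b , w) →
                    Σ[ u ∈ Hom a b ] Σ[ p ∈ InSub C h (a , b , u) ] F₁ u p ≡ w
    F₁-surjective {a} {b} pa pb w q with surjective _ q
    ... | (a₀ , b₀ , u) , p , e =
      aligned u p (F₀-injective (id-dom∈Sub p) pa (cong proj₁ e))
                  (F₀-injective (id-cod∈Sub p) pb (cong (λ m → proj₁ (proj₂ m)) e)) e
      where
      aligned : ∀ {a₀ b₀} (u : Hom a₀ b₀) (p : InSub C h (a₀ , b₀ , u)) → a₀ ≡ a → b₀ ≡ b →
                FMor _ p ≡ (F₀ a , F₀ b , w) →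
                Σ[ u ∈ Hom a b ] Σ[ p ∈ InSub C h (a , b , u) ] F₁ u p ≡ w
      aligned u p refl refl e = u , p , Hom-≡ e

  module _ {I : Set} {ℓ : Mor C → I} {x z : Obj} {h : Hom x z} {k : Mor C}
           (G : GoodFunctor C ℓ (x , z , h) k) {i j : I} where
    open GoodFunctor G
    open GoodFunctorProperties G

    private
      h∈Sub : InSub C (x , z , h) (x , z , h)
      h∈Sub = self∈Sub C (x , z , h)

      φh : Mor C
      φh = FMor _ h∈Sub

      ∈Sub-image⇒∈Sub-k : ∀ {m} → InSub C φh m → InSub C k m
      ∈Sub-image⇒∈Sub-k {m} = subst (λ n → InSub C n m) sends

    N-map : N C ℓ i j (x , z , h) → N C ℓ i j φh
    N-map (y , f , g , li , lj , e) =
      F₀ y , F₁ f pf , F₁ g pg ,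
      trans (sym (label _ pf)) li , trans (sym (label _ pg)) lj ,
      trans (sym (F-∘ f g pf pg (comp pf pg))) (F₁-cong e _ h∈Sub)
      where
      pf = left-factor∈Sub e
      pg = right-factor∈Sub e

    N-map-injective : ∀ {n n′} → N-map n ≡ N-map n′ → n ≡ n′
    N-map-injective {_ , f , g , _ , _ , e} {_ , f′ , g′ , _ , _ , e′} E =
      N-≡ {ℓ = ℓ} (injective _ _ (left-factor∈Sub e) (left-factor∈Sub e′)
                                   (cong (λ { (o , u , _) → o , F₀ z , u }) E))
                  (injective _ _ (right-factor∈Sub e) (right-factor∈Sub e′)
                                   (cong (λ { (o , _ , v , _) → F₀ x , o , v }) E))

    private
      N-map-hits : ∀ {a} (f′ : Hom (F₀ a) (F₀ z)) (g′ : Hom (F₀ x) (F₀ a)) li lj e →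
                   InSub C (x , z , h) (a , a , id a) →
                   Σ[ n ∈ N C ℓ i j (x , z , h) ] N-map n ≡ (F₀ a , f′ , g′ , li , lj , e)
      N-map-hits f′ g′ li lj e pa
        with F₁-surjective pa (id-cod∈Sub h∈Sub) f′ (∈Sub-image⇒∈Sub-k (left-factor∈Sub e))
           | F₁-surjective (id-dom∈Sub h∈Sub) pa g′ (∈Sub-image⇒∈Sub-k (right-factor∈Sub e))
      ... | f , pf , refl | g , pg , refl =
        (_ , f , g , trans (label _ pf) li , trans (label _ pg) lj , fg≡h) ,
        N-≡ {ℓ = ℓ} (cong (λ w → _ , _ , w) (F₁-irr f _ _))
                    (cong (λ w → _ , _ , w) (F₁-irr g _ _))
        where
        fg≡h : f ∘ g ≡ h
        fg≡h = F₁-faithful (comp pf pg) h∈Sub (trans (F-∘ f g pf pg (comp pf pg)) e)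

    N-map-surjective : ∀ n′ → Σ[ n ∈ N C ℓ i j (x , z , h) ] N-map n ≡ n′
    N-map-surjective (y′ , f′ , g′ , li , lj , e) with surjective _ (∈Sub-image⇒∈Sub-k (right-factor∈Sub e))
    ... | (_ , a , _) , p , E = hits (cong (λ m → proj₁ (proj₂ m)) E)
      where
      hits : F₀ a ≡ y′ → Σ[ n ∈ N C ℓ i j (x , z , h) ] N-map n ≡ (y′ , f′ , g′ , li , lj , e)
      hits refl = N-map-hits f′ g′ li lj e (id-cod∈Sub p)

    N↔N-image : N C ℓ i j (x , z , h) ↔ N C ℓ i j φh
    N↔N-image = ⤖⇒↔ (mk⤖ (N-map-injective , strictlySurjective⇒surjective N-map-surjective))

lemma2p2 : (C : Category) (I : Set) (ℓ : Mor C → I) →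
           NoNonIdentityEndos C →
           (∀ f g → ℓ f ≡ ℓ g → GoodFunctor C ℓ f g) →
           IsSchemoid C ℓ
lemma2p2 C I ℓ _ good i j h k ℓh≡ℓk =
  subst (λ m → N C ℓ i j h ↔ N C ℓ i j m) (GoodFunctor.sends G) (N↔N-image C G)
  where G = good h k ℓh≡ℓk
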